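{- Let $U=\{u_1,\ldots,u_n\}$ be a finite set and let $\mathcal{T}=\{T_1,\ldots,T_m\}$ be a collection of nonempty subsets of $U$. Let $r\notin U$ be a new vertex and form the edge-weighted graph $G=(V,E)$ with $V=U\cup\{r\}$ and $E=K_U\cup\{\{r,u_i\}: u_i\in U\}$, where $K_U$ is the edge set of the complete graph on $U$; each edge of $K_U$ has weight $1$ and each edge $\{r,u_i\}$ has weight $n^3$. Consider the vertex subsets $S_{\{i,j\}}=\{u_i,u_j\}$ for $1\le i<j\le n$ and $S'_i=T_i\cup\{r\}$ for $1\le i\le m$. Let $h$ be the minimum weight of a set $F\subseteq E$ such that, for every one of these vertex subsets $S$, $F$ contains a spanning tree of the induced subgraph $G[S]$. Let $h'$ be the minimum cardinality of a hitting set for $\mathcal{T}$, i.e. of a set $C\subseteq U$ with $C\cap T_i\neq\emptyset$ for all $i$. Then $h=h'\cdot n^3+\binom{n}{2}$.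
   Context: The weight of an edge set is the sum of the weights of its edges. For $S\subseteq V$, $G[S]$ denotes the subgraph of $G$ induced on $S$, and "$F$ contains a spanning tree of $G[S]$" means some subset of $F$ consisting of edges with both endpoints in $S$ forms a spanning tree on vertex set $S$. -}

module Defs where

open import Data.Nat using (ℕ; zero; suc; _+_; _*_; _^_; _≤_)
open import Data.Nat.Combinatorics using (_C_)
open import Data.Fin using (Fin; zero; suc; _<_)
open import Data.Fin.Subset using (Subset; _∈_; _∩_; _∪_; ⁅_⁆; ∣_∣; Nonempty; inside)
open import Data.Fin.Properties using (_≟_)
open import Data.Bool using (Bool; true; false; _∧_; not; if_then_else_)
open import Data.List using (List; map; allFin)
open import Data.Nat.ListAction using (sum)
open import Data.Vec using (_∷_)
open import Data.Product using (Σ; _×_; _,_; ∃)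
open import Data.Sum using (_⊎_)
open import Relation.Binary.PropositionalEquality using (_≡_)
open import Relation.Nullary using (¬_)
open import Relation.Nullary.Decidable using (⌊_⌋; does)
open import Data.Fin using (_<?_)

-- An edge {a,b} (a ≠ b) is stored canonically at position (a , b) with
-- a < b; entries with a ≥ b are ignored.  So every edge set of K_N is
-- represented, and every such function denotes a subset of E(K_N).

EdgeSet : ℕ → Set
EdgeSet N = Fin N → Fin N → Bool

Adj : ∀ {N} → EdgeSet N → Fin N → Fin N → Set
Adj F a b = (a < b × F a b ≡ true) ⊎ (b < a × F b a ≡ true)

_⊆E_ : ∀ {N} → EdgeSet N → EdgeSet N → Set
T ⊆E F = ∀ a b → Adj T a b → Adj F a b

removeEdge : ∀ {N} → EdgeSet N → Fin N → Fin N → EdgeSet N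
removeEdge F a b x y =
  F x y ∧ not ((does (x ≟ a) ∧ does (y ≟ b)) Data.Bool.∨ (does (x ≟ b) ∧ does (y ≟ a)))

data Reach {N} (T : EdgeSet N) (a : Fin N) : Fin N → Set where
  here : Reach T a a
  step : ∀ {b c} → Reach T a b → Adj T b c → Reach T a c

IsSpanningTree : ∀ {N} → Subset N → EdgeSet N → Set
IsSpanningTree S T =
  (∀ a b → Adj T a b → a ∈ S × b ∈ S) ×
  (∀ a b → a ∈ S → b ∈ S → Reach T a b) ×
  (∀ a b → Adj T a b → ¬ Reach (removeEdge T a b) a b)

ContainsSpanningTree : ∀ {N} → EdgeSet N → Subset N → Set
ContainsSpanningTree F S = Σ (EdgeSet _) λ T → T ⊆E F × IsSpanningTree S T

-- The construction.  U = {u_1..u_n} is Fin n; V = Fin (suc n) with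
-- r = zero and u_i = suc i.  E = K_U ∪ {{r,u_i}} is exactly the edge
-- set of the complete graph on V.

edgeWeight : (n : ℕ) → Fin (suc n) → Fin (suc n) → ℕ
edgeWeight n zero    _       = n ^ 3
edgeWeight n (suc _) zero    = n ^ 3
edgeWeight n (suc _) (suc _) = 1

weight : (n : ℕ) → EdgeSet (suc n) → ℕ
weight n F = sum (map (λ a → sum (map (λ b →
  if does (a <? b) ∧ F a b then edgeWeight n a b else 0) (allFin (suc n)))) (allFin (suc n)))

Spair : ∀ {n} → Fin n → Fin n → Subset (suc n)
Spair i j = ⁅ suc i ⁆ ∪ ⁅ suc j ⁆

Sroot : ∀ {n} → Subset n → Subset (suc n)
Sroot T = inside ∷ T

Feasible : ∀ {n m} → (Fin m → Subset n) → EdgeSet (suc n) → Set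
Feasible {n} 𝒯 F =
  (∀ (i j : Fin n) → i < j → ContainsSpanningTree F (Spair i j)) ×
  (∀ k → ContainsSpanningTree F (Sroot (𝒯 k)))

IsHittingSet : ∀ {n m} → (Fin m → Subset n) → Subset n → Set
IsHittingSet 𝒯 C = ∀ k → Nonempty (C ∩ 𝒯 k)

IsMinimum : ∀ {A : Set} → (A → Set) → (A → ℕ) → ℕ → Set
IsMinimum P f h = (Σ _ λ x → P x × f x ≡ h) × (∀ x → P x → h ≤ f x)

-- A feasible F must contain every edge {u_i, u_j}, since the only spanning tree of
-- G[{u_i, u_j}] is that edge, and for each T_k some edge {r, u} with u ∈ T_k, since a
-- spanning tree of G[T_k ∪ {r}] has an edge at r.  So the neighbourhood of r in F is a
-- hitting set, and weight F = |N(r)|·n³ + (n choose 2) ≥ h′·n³ + (n choose 2).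
-- Conversely, K_U together with the edges from r to a minimum hitting set H is feasible,
-- every G[S] being spanned by a star centred at u_i resp. at some u ∈ H ∩ T_k.
module Submission where

open import Defs
open import Data.Nat using (ℕ; _+_; _*_; _^_)
open import Data.Nat.Combinatorics using (_C_)
open import Data.Fin using (Fin)
open import Data.Fin.Subset using (Subset; Nonempty; ∣_∣)
open import Relation.Binary.PropositionalEquality using (_≡_)

open import Data.Nat as ℕ using (z≤n; s≤s)
open import Data.Nat.Properties using (≤-antisym; +-monoˡ-≤; *-monoˡ-≤; module ≤-Reasoning)
open import Data.Nat.Combinatorics using (nCk+nC[k+1]≡[n+1]C[k+1]; nC1≡n)
open import Data.Nat.ListAction using (sum)
open import Data.Fin using (zero; suc; _<_; _<?_)
open import Data.Fin.Properties using (_≟_; <-cmp; <-irrefl; <-asym)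
open import Data.Fin.Subset using (_∈_; _∩_; _∪_; ⁅_⁆)
open import Data.Fin.Subset.Properties
  using (x∈⁅x⁆; x∈⁅y⁆⇒x≡y; x∈p∪q⁺; x∈p∪q⁻; x∈p∩q⁺; x∈p∩q⁻)
open import Data.Bool using (Bool; true; false; _∧_; _∨_; if_then_else_)
open import Data.Bool.Properties using (∧-zeroʳ; ∨-zeroʳ; ∧-conicalˡ)
open import Data.List as List using (map; allFin)
open import Data.List.Properties using (map-tabulate; tabulate-cong)
open import Data.Vec as Vec using (lookup; here; there)
open import Data.Vec.Properties
  using (lookup∘tabulate; tabulate∘lookup; []=⇒lookup; lookup⇒[]=)
open import Data.Product using (_×_; _,_; ∃; proj₁; proj₂)
open import Data.Sum using (_⊎_; inj₁; inj₂)
open import Data.Empty using (⊥-elim)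
open import Relation.Nullary using (¬_; Dec; yes; no; does)
open import Relation.Nullary.Decidable using (dec-true)
open import Relation.Binary using (tri<; tri≈; tri>)
open import Relation.Binary.PropositionalEquality
  using (refl; sym; trans; cong; cong₂; subst; module ≡-Reasoning)
open import Function using (id)

private
  variable
    N : ℕ
    F T : EdgeSet N
    a b c t : Fin N

Adj-sym : Adj T a b → Adj T b a
Adj-sym (inj₁ e) = inj₂ e
Adj-sym (inj₂ e) = inj₁ e

Adj⇒≢ : Adj T a b → ¬ a ≡ b
Adj⇒≢ (inj₁ (a<b , _)) refl = <-irrefl refl a<b
Adj⇒≢ (inj₂ (b<a , _)) refl = <-irrefl refl b<a

Adj⇒true : a < b → Adj T a b → T a b ≡ true
Adj⇒true a<b (inj₁ (_ , e))   = e
Adj⇒true a<b (inj₂ (b<a , _)) = ⊥-elim (<-asym a<b b<a)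

Reach-trans : Reach T a b → Reach T b c → Reach T a c
Reach-trans r here        = r
Reach-trans r (step s e) = step (Reach-trans r s) e

Reach-sym : Reach T a b → Reach T b a
Reach-sym here               = here
Reach-sym {T = T} (step r e) = Reach-trans (step here (Adj-sym {T = T} e)) (Reach-sym r)

Reach-firstEdge : Reach T a b → a ≡ b ⊎ ∃ λ x → Adj T a x
Reach-firstEdge here = inj₁ refl
Reach-firstEdge (step r e) with Reach-firstEdge r
... | inj₁ refl = inj₂ (_ , e)
... | inj₂ first = inj₂ first

Reach-lastEdge : Reach T a b → a ≡ b ⊎ ∃ λ x → Adj T x b
Reach-lastEdge here       = inj₁ refl
Reach-lastEdge (step _ e) = inj₂ (_ , e)

Isolated : EdgeSet N → Fin N → Set
Isolated T t = ∀ x → ¬ Adj T x t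

Reach-to-isolated : Isolated T t → Reach T a t → a ≡ t
Reach-to-isolated iso here       = refl
Reach-to-isolated iso (step _ e) = ⊥-elim (iso _ e)

Reach-from-isolated : Isolated T t → Reach T t b → b ≡ t
Reach-from-isolated iso here = refl
Reach-from-isolated {T = T} iso (step r e) with Reach-from-isolated iso r
... | refl = ⊥-elim (iso _ (Adj-sym {T = T} e))

false≢true : ¬ false ≡ true
false≢true ()

removeEdge-⊆ : removeEdge F a b ⊆E F
removeEdge-⊆ {F = F} a b (inj₁ (a<b , e)) = inj₁ (a<b , ∧-conicalˡ (F a b) _ e)
removeEdge-⊆ {F = F} a b (inj₂ (b<a , e)) = inj₂ (b<a , ∧-conicalˡ (F b a) _ e)

removeEdge-removes : ¬ Adj (removeEdge F a b) a b
removeEdge-removes {F = F} {a = a} {b} (inj₁ (_ , e))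
  rewrite dec-true (a ≟ a) refl | dec-true (b ≟ b) refl | ∧-zeroʳ (F a b) = false≢true e
removeEdge-removes {F = F} {a = a} {b} (inj₂ (_ , e))
  rewrite dec-true (a ≟ a) refl | dec-true (b ≟ b) refl
        | ∨-zeroʳ (does (b ≟ a) ∧ does (a ≟ b)) | ∧-zeroʳ (F b a) = false≢true e

removeEdge-leaf-isolated : ∀ {s} → (∀ x → Adj F x t → x ≡ s) →
                           ¬ Adj (removeEdge F a b) s t → Isolated (removeEdge F a b) t
removeEdge-leaf-isolated {F = F} {t = t} leaf st∉ x e with leaf x (removeEdge-⊆ {F = F} x t e)
... | refl = st∉ e

leafEdge-isBridge : (∀ x → Adj F x b → x ≡ a) ⊎ (∀ x → Adj F x a → x ≡ b) →
                    Adj F a b → ¬ Reach (removeEdge F a b) a b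
leafEdge-isBridge {F = F} {b = b} {a = a} (inj₁ b-leaf) ab r =
  Adj⇒≢ {T = F} ab (Reach-to-isolated b-isolated r)
  where
  b-isolated : Isolated (removeEdge F a b) b
  b-isolated = removeEdge-leaf-isolated {F = F} b-leaf (removeEdge-removes {F = F})
leafEdge-isBridge {F = F} {b = b} {a = a} (inj₂ a-leaf) ab r =
  Adj⇒≢ {T = F} ab (sym (Reach-from-isolated a-isolated r))
  where
  a-isolated : Isolated (removeEdge F a b) a
  a-isolated = removeEdge-leaf-isolated {F = F} a-leaf
                 (λ ba → removeEdge-removes {F = F} (Adj-sym {T = removeEdge F a b} ba))

star : Fin N → Subset N → EdgeSet N
star c S x y = (does (x ≟ c) ∧ lookup S y) ∨ (does (y ≟ c) ∧ lookup S x)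

module _ {c : Fin N} {S : Subset N} where

  star-true : ∀ x y → star c S x y ≡ true → (x ≡ c × y ∈ S) ⊎ (y ≡ c × x ∈ S)
  star-true x y e with x ≟ c | y ≟ c | lookup S y in Sy | lookup S x in Sx
  ... | yes x≡c | _       | true  | _     = inj₁ (x≡c , lookup⇒[]= y S Sy)
  ... | _       | yes y≡c | _     | true  = inj₂ (y≡c , lookup⇒[]= x S Sx)
  ... | yes _   | yes _   | false | false = ⊥-elim (false≢true e)
  ... | yes _   | no _    | false | _     = ⊥-elim (false≢true e)
  ... | no _    | yes _   | _     | false = ⊥-elim (false≢true e)
  ... | no _    | no _    | _     | _     = ⊥-elim (false≢true e)

  star-edge : Adj (star c S) a b → (a ≡ c × b ∈ S) ⊎ (b ≡ c × a ∈ S)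
  star-edge {a = a} {b} (inj₁ (_ , e)) = star-true a b e
  star-edge {a = a} {b} (inj₂ (_ , e)) with star-true b a e
  ... | inj₁ p = inj₂ p
  ... | inj₂ p = inj₁ p

  star-leaf : ¬ t ≡ c → ∀ x → Adj (star c S) x t → x ≡ c
  star-leaf t≢c x e with star-edge e
  ... | inj₁ (x≡c , _) = x≡c
  ... | inj₂ (t≡c , _) = ⊥-elim (t≢c t≡c)

  star-centreEdge : b ∈ S → ¬ b ≡ c → Adj (star c S) c b
  star-centreEdge {b = b} b∈S b≢c with <-cmp c b
  ... | tri< c<b _ _ rewrite dec-true (c ≟ c) refl | []=⇒lookup b∈S = inj₁ (c<b , refl)
  ... | tri≈ _ c≡b _ = ⊥-elim (b≢c (sym c≡b))
  ... | tri> _ _ b<c rewrite dec-true (c ≟ c) refl | []=⇒lookup b∈S =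
    inj₂ (b<c , ∨-zeroʳ (does (b ≟ c) ∧ lookup S c))

  star-reach : b ∈ S → Reach (star c S) c b
  star-reach {b = b} b∈S with b ≟ c
  ... | yes refl = here
  ... | no b≢c   = step here (star-centreEdge b∈S b≢c)

  star-isSpanningTree : c ∈ S → IsSpanningTree S (star c S)
  star-isSpanningTree c∈S = withinS , connected , acyclic
    where
    withinS : ∀ a b → Adj (star c S) a b → a ∈ S × b ∈ S
    withinS a b e with star-edge e
    ... | inj₁ (refl , b∈S) = c∈S , b∈S
    ... | inj₂ (refl , a∈S) = a∈S , c∈S
    connected : ∀ a b → a ∈ S → b ∈ S → Reach (star c S) a b
    connected a b a∈S b∈S = Reach-trans (Reach-sym (star-reach a∈S)) (star-reach b∈S)
    acyclic : ∀ a b → Adj (star c S) a b → ¬ Reach (removeEdge (star c S) a b) a b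
    acyclic a b e with star-edge e
    ... | inj₁ (refl , _) =
      leafEdge-isBridge (inj₁ (star-leaf (λ b≡a → Adj⇒≢ {T = star c S} e (sym b≡a)))) e
    ... | inj₂ (refl , _) = leafEdge-isBridge (inj₂ (star-leaf (Adj⇒≢ {T = star c S} e))) e

  star-⊆ : (∀ x → x ∈ S → ¬ x ≡ c → Adj F c x) → star c S ⊆E F
  star-⊆ {F = F} centreEdges a b e with star-edge e
  ... | inj₁ (refl , b∈S) = centreEdges b b∈S (λ b≡a → Adj⇒≢ {T = star c S} e (sym b≡a))
  ... | inj₂ (refl , a∈S) = Adj-sym {T = F} (centreEdges a a∈S (Adj⇒≢ {T = star c S} e))

spanningPair⇒edge : a < b → ContainsSpanningTree F (⁅ a ⁆ ∪ ⁅ b ⁆) → F a b ≡ true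
spanningPair⇒edge {a = a} {b = b} {F = F} a<b (T , T⊆F , withinS , connected , _)
  with Reach-lastEdge (connected a b (x∈p∪q⁺ (inj₁ (x∈⁅x⁆ a)))
                                     (x∈p∪q⁺ {p = ⁅ a ⁆} (inj₂ (x∈⁅x⁆ b))))
... | inj₁ a≡b = ⊥-elim (<-irrefl a≡b a<b)
... | inj₂ (x , xb) with x∈p∪q⁻ ⁅ a ⁆ ⁅ b ⁆ (proj₁ (withinS x b xb))
...   | inj₁ x∈⁅a⁆ rewrite x∈⁅y⁆⇒x≡y a x∈⁅a⁆ = Adj⇒true {T = F} a<b (T⊆F a b xb)
...   | inj₂ x∈⁅b⁆ = ⊥-elim (Adj⇒≢ {T = T} xb (x∈⁅y⁆⇒x≡y b x∈⁅b⁆))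

spanningRooted⇒rootEdge : ∀ {n} {F : EdgeSet (ℕ.suc n)} {S : Subset n} →
                          Nonempty S → ContainsSpanningTree F (Sroot S) →
                          ∃ λ s → s ∈ S × F zero (suc s) ≡ true
spanningRooted⇒rootEdge {F = F} (t , t∈S) (T , T⊆F , withinS , connected , _)
  with Reach-firstEdge (connected zero (suc t) here (there t∈S))
... | inj₂ (zero , e) = ⊥-elim (Adj⇒≢ {T = T} e refl)
... | inj₂ (suc s , e) with proj₂ (withinS zero (suc s) e)
...   | there s∈S = s , s∈S , Adj⇒true {T = F} (s≤s z≤n) (T⊆F zero (suc s) e)

rootNeighbours : ∀ {n} → EdgeSet (ℕ.suc n) → Subset n
rootNeighbours F = Vec.tabulate (λ t → F zero (suc t))

module _ {n m : ℕ} {𝒯 : Fin m → Subset n} {F : EdgeSet (ℕ.suc n)} where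

  feasible⇒cliqueOnU : Feasible 𝒯 F → ∀ s t → s < t → F (suc s) (suc t) ≡ true
  feasible⇒cliqueOnU (pairs , _) s t s<t = spanningPair⇒edge (s≤s s<t) (pairs s t s<t)

  feasible⇒rootNeighboursHit : (∀ k → Nonempty (𝒯 k)) → Feasible 𝒯 F →
                               IsHittingSet 𝒯 (rootNeighbours F)
  feasible⇒rootNeighboursHit nonempty (_ , rooted) k
    with spanningRooted⇒rootEdge (nonempty k) (rooted k)
  ... | s , s∈Tₖ , e =
    s , x∈p∩q⁺ (lookup⇒[]= s _ (trans (lookup∘tabulate (λ t → F zero (suc t)) s) e) , s∈Tₖ)

weight-tabulate : ∀ n (F : EdgeSet (ℕ.suc n)) →
  weight n F ≡ sum (List.tabulate λ a → sum (List.tabulate λ b →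
                  if does (a <? b) ∧ F a b then edgeWeight n a b else 0))
weight-tabulate n F =
  trans (cong sum (map-tabulate id (λ a → sum (map (term a) (allFin (ℕ.suc n))))))
        (cong sum (tabulate-cong λ a → cong sum (map-tabulate id (term a))))
  where
  term : Fin (ℕ.suc n) → Fin (ℕ.suc n) → ℕ
  term a b = if does (a <? b) ∧ F a b then edgeWeight n a b else 0

sum-tabulate-if : ∀ {n} (f : Fin n → Bool) k →
                  sum (List.tabulate λ t → if f t then k else 0) ≡ ∣ Vec.tabulate f ∣ * k
sum-tabulate-if {ℕ.zero}  f k = refl
sum-tabulate-if {ℕ.suc n} f k with f zero
... | true  = cong (k +_) (sum-tabulate-if (λ t → f (suc t)) k)
... | false = sum-tabulate-if (λ t → f (suc t)) k

sum-tabulate-1 : ∀ n → sum (List.tabulate {n = n} λ _ → 1) ≡ n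
sum-tabulate-1 ℕ.zero    = refl
sum-tabulate-1 (ℕ.suc n) = cong ℕ.suc (sum-tabulate-1 n)

increasingPairs : ℕ → ℕ
increasingPairs n =
  sum (List.tabulate λ (s : Fin n) → sum (List.tabulate λ (t : Fin n) →
    if does (s <? t) then 1 else 0))

increasingPairs≡nC2 : ∀ n → increasingPairs n ≡ n C 2
increasingPairs≡nC2 ℕ.zero    = refl
increasingPairs≡nC2 (ℕ.suc n) = begin
  increasingPairs (ℕ.suc n)
    ≡⟨⟩ -- row 0 counts every t ≠ 0; row (suc s) is row s of the smaller count
  sum (List.tabulate {n = n} λ _ → 1) + increasingPairs n
    ≡⟨ cong₂ _+_ (sum-tabulate-1 n) (increasingPairs≡nC2 n) ⟩
  n + n C 2
    ≡⟨ cong (_+ n C 2) (nC1≡n n) ⟨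
  n C 1 + n C 2
    ≡⟨ nCk+nC[k+1]≡[n+1]C[k+1] n 1 ⟩
  ℕ.suc n C 2
    ∎
  where open ≡-Reasoning

weight-⊇cliqueOnU : ∀ n (F : EdgeSet (ℕ.suc n)) →
                    (∀ s t → s < t → F (suc s) (suc t) ≡ true) →
                    weight n F ≡ ∣ rootNeighbours F ∣ * n ^ 3 + n C 2
weight-⊇cliqueOnU n F clique = begin
  weight n F
    ≡⟨ weight-tabulate n F ⟩
  -- definitionally: the row of r contributes n³ per root edge, the other rows count
  -- edges inside U with weight 1, and no pair (a , r) has a < r.
  sum (List.tabulate λ t → if F zero (suc t) then n ^ 3 else 0) +
  sum (List.tabulate λ (s : Fin n) → sum (List.tabulate λ (t : Fin n) →
         if does (s <? t) ∧ F (suc s) (suc t) then 1 else 0))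
    ≡⟨ cong₂ _+_ (sum-tabulate-if (λ t → F zero (suc t)) (n ^ 3))
                 (cong sum (tabulate-cong λ s → cong sum (tabulate-cong (cliqueTerm s)))) ⟩
  ∣ rootNeighbours F ∣ * n ^ 3 + increasingPairs n
    ≡⟨ cong (∣ rootNeighbours F ∣ * n ^ 3 +_) (increasingPairs≡nC2 n) ⟩
  ∣ rootNeighbours F ∣ * n ^ 3 + n C 2
    ∎
  where
  open ≡-Reasoning
  cliqueTerm : ∀ s t → (if does (s <? t) ∧ F (suc s) (suc t) then 1 else 0) ≡
                    (if does (s <? t) then 1 else 0)
  cliqueTerm s t = decided (s <? t)
    where
    decided : (s<?t : Dec (s < t)) → (if does s<?t ∧ F (suc s) (suc t) then 1 else 0) ≡
                                     (if does s<?t then 1 else 0)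
    decided (yes s<t) rewrite clique s t s<t = refl
    decided (no _)    = refl

rootedClique : ∀ {n} → Subset n → EdgeSet (ℕ.suc n)
rootedClique H zero    zero    = false
rootedClique H zero    (suc t) = lookup H t
rootedClique H (suc t) zero    = lookup H t
rootedClique H (suc _) (suc _) = true

module _ {n : ℕ} {H : Subset n} where

  rootedClique-UEdge : ∀ {s t} → ¬ s ≡ t → Adj (rootedClique H) (suc s) (suc t)
  rootedClique-UEdge {s} {t} s≢t with <-cmp s t
  ... | tri< s<t _ _ = inj₁ (s≤s s<t , refl)
  ... | tri≈ _ s≡t _ = ⊥-elim (s≢t s≡t)
  ... | tri> _ _ t<s = inj₂ (s≤s t<s , refl)

  rootedClique-rootEdge : ∀ {t} → t ∈ H → Adj (rootedClique H) zero (suc t)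
  rootedClique-rootEdge t∈H = inj₁ (s≤s z≤n , []=⇒lookup t∈H)

  rootedClique-feasible : ∀ {m} {𝒯 : Fin m → Subset n} → IsHittingSet 𝒯 H →
                          Feasible 𝒯 (rootedClique H)
  rootedClique-feasible {𝒯 = 𝒯} hits = pairs , rooted
    where
    pairs : ∀ i j → i < j → ContainsSpanningTree (rootedClique H) (Spair i j)
    pairs i j _ = star (suc i) (Spair i j) , star-⊆ centreEdges ,
                  star-isSpanningTree (x∈p∪q⁺ (inj₁ (x∈⁅x⁆ (suc i))))
      where
      centreEdges : ∀ x → x ∈ Spair i j → ¬ x ≡ suc i → Adj (rootedClique H) (suc i) x
      centreEdges zero    ()
      centreEdges (suc s) _ s≢i = rootedClique-UEdge (λ i≡s → s≢i (cong suc (sym i≡s)))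
    rooted : ∀ k → ContainsSpanningTree (rootedClique H) (Sroot (𝒯 k))
    rooted k with hits k
    ... | t , t∈H∩Tₖ with x∈p∩q⁻ H (𝒯 k) t∈H∩Tₖ
    ... | t∈H , t∈Tₖ =
      star (suc t) (Sroot (𝒯 k)) , star-⊆ centreEdges , star-isSpanningTree (there t∈Tₖ)
      where
      centreEdges : ∀ x → x ∈ Sroot (𝒯 k) → ¬ x ≡ suc t → Adj (rootedClique H) (suc t) x
      centreEdges zero    _ _   = Adj-sym {T = rootedClique H} (rootedClique-rootEdge t∈H)
      centreEdges (suc s) _ s≢t = rootedClique-UEdge (λ t≡s → s≢t (cong suc (sym t≡s)))

  weight-rootedClique : weight n (rootedClique H) ≡ ∣ H ∣ * n ^ 3 + n C 2
  weight-rootedClique =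
    trans (weight-⊇cliqueOnU n (rootedClique H) (λ _ _ _ → refl))
          (cong (λ D → ∣ D ∣ * n ^ 3 + n C 2) (tabulate∘lookup H))

claim1 : (n m : ℕ) (𝒯 : Fin m → Subset n) → (∀ k → Nonempty (𝒯 k)) →
         (h h′ : ℕ) →
         IsMinimum (Feasible 𝒯) (weight n) h →
         IsMinimum (IsHittingSet 𝒯) ∣_∣ h′ →
         h ≡ h′ * n ^ 3 + n C 2
claim1 n m 𝒯 nonempty h h′ ((F , F-feasible , weightF≡h) , h-minimal)
                           ((H , H-hits , ∣H∣≡h′) , h′-minimal) = ≤-antisym upper lower
  where
  open ≤-Reasoning
  upper : h ℕ.≤ h′ * n ^ 3 + n C 2
  upper = begin
    h                              ≤⟨ h-minimal (rootedClique H) (rootedClique-feasible H-hits) ⟩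
    weight n (rootedClique H)      ≡⟨ weight-rootedClique {H = H} ⟩
    ∣ H ∣ * n ^ 3 + n C 2          ≡⟨ cong (λ c → c * n ^ 3 + n C 2) ∣H∣≡h′ ⟩
    h′ * n ^ 3 + n C 2             ∎
  lower : h′ * n ^ 3 + n C 2 ℕ.≤ h
  lower = begin
    h′ * n ^ 3 + n C 2                   ≤⟨ +-monoˡ-≤ (n C 2) (*-monoˡ-≤ (n ^ 3) h′≤∣Nr∣) ⟩
    ∣ rootNeighbours F ∣ * n ^ 3 + n C 2 ≡⟨ weight-⊇cliqueOnU n F (feasible⇒cliqueOnU F-feasible) ⟨
    weight n F                           ≡⟨ weightF≡h ⟩
    h                                    ∎
    where
    h′≤∣Nr∣ : h′ ℕ.≤ ∣ rootNeighbours F ∣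
    h′≤∣Nr∣ = h′-minimal (rootNeighbours F) (feasible⇒rootNeighboursHit nonempty F-feasible)
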